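{- Let a GCR game family be given and let $\overline{T}(s)=\lim_{i\to\infty}T^i(s)$, $s\in\overline{S}$, where $T^i$ are the labels produced by the vertex labeling algorithm. Then for all $s\in S^1\setminus S_c$: $\overline{T}(s)=1+\min_{s'\in N(s)}\overline{T}(s')$, and for all $s\in S^2\setminus S_c$: $\overline{T}(s)=1+\max_{s'\in N(s)}\overline{T}(s')$ (with the convention $1+\infty=\infty$).
   Context: A GCR game family consists of: finite location sets $V^1,V^2$; the set of nonterminal states $\overline{S}=V^1\times V^2\times\{1,2\}$, where in state $(x^1,x^2,n)$ player $P^n$ has the move ($P^1$ is the Pursuer, $P^2$ the Evader); $S^n=\{(x^1,x^2,n)\}$ for $n\in\{1,2\}$; a set of capture states $S_c\subseteq\overline{S}$, with $S_{nc}=\overline{S}\setminus S_c$; for each $s\in S_{nc}$ a nonempty set $N(s)\subseteq\overline{S}$ of possible next states. Players need not alternate. Vertex labeling algorithm: for $s\in\overline{S}$ set $T^0(s)=0$ if $s\in S_c$ and $T^0(s)=\infty$ otherwise. For $i=1,2,\dots$ and each $s\in\overline{S}$: if $T^{i-1}(s)<\infty$ set $T^i(s)=T^{i-1}(s)$; otherwise, if $s\in S^1$ set $T^i(s)=1+\min_{s'\in N(s)}T^{i-1}(s')$, and if $s\in S^2$ set $T^i(s)=1+\max_{s'\in N(s)}T^{i-1}(s')$ (with $1+\infty=\infty$). For each $s$ the sequence $(T^i(s))_i$ is eventually constant, so the limit exists in $\mathbb{N}_0\cup\{\infty\}$. -}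

module Defs where

open import Data.Nat using (ℕ; zero; suc; _⊓_; _⊔_)
open import Data.Fin using (Fin)
open import Data.Bool using (Bool; true; false; if_then_else_)
open import Data.Product using (_×_; _,_)
open import Data.List.NonEmpty using (List⁺; foldr₁) renaming (map to map⁺)

data ℕ∞ : Set where
  fin : ℕ → ℕ∞
  ∞   : ℕ∞

suc∞ : ℕ∞ → ℕ∞
suc∞ (fin n) = fin (suc n)
suc∞ ∞       = ∞

_⊓∞_ : ℕ∞ → ℕ∞ → ℕ∞
fin m ⊓∞ fin n = fin (m ⊓ n)
fin m ⊓∞ ∞     = fin m
∞     ⊓∞ y     = y

_⊔∞_ : ℕ∞ → ℕ∞ → ℕ∞
fin m ⊔∞ fin n = fin (m ⊔ n)
fin m ⊔∞ ∞     = ∞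
∞     ⊔∞ y     = ∞

min⁺ : List⁺ ℕ∞ → ℕ∞
min⁺ = foldr₁ _⊓∞_

max⁺ : List⁺ ℕ∞ → ℕ∞
max⁺ = foldr₁ _⊔∞_

-- Players: P¹ (Pursuer) and P² (Evader)
data Player : Set where
  pursuer evader : Player

-- A GCR game family.  Locations V¹ = Fin n¹, V² = Fin n².
record GCR : Set where
  field
    n¹ n² : ℕ
  -- nonterminal states S̄ = V¹ × V² × {1,2}
  State : Set
  State = Fin n¹ × Fin n² × Player
  field
    -- characteristic function of the capture set S_c
    capture : State → Bool
    -- nonempty finite family of possible next states N(s)
    -- (only consulted for s ∉ S_c)
    N : State → List⁺ State

  player : State → Player
  player (_ , _ , p) = p

  T : ℕ → State → ℕ∞
  step : Player → List⁺ ℕ∞ → ℕ∞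
  step pursuer xs = suc∞ (min⁺ xs)
  step evader  xs = suc∞ (max⁺ xs)
  T zero s = if capture s then fin 0 else ∞
  T (suc i) s with T i s
  ... | fin n = fin n
  ... | ∞     = step (player s) (map⁺ (T i) (N s))

module Submission where

-- Write ⌊x⌋ₖ = trunc k x for x ∈ ℕ ∪ {∞} truncated at k:
-- finite values ≤ k are kept, everything else becomes ∞.  The labelling
-- algorithm only ever fixes labels it will never change, and a label fixed
-- at round i is at most i; this is captured by the invariant
--     Tⁱ = ⌊Tⁱ⁺¹⌋ᵢ ,   hence   Tⁱ = ⌊T̄⌋ᵢ   for the limit T̄.
-- Truncation commutes with ⊓∞ and ⊔∞, and ⌊suc∞ x⌋ₖ₊₁ = suc∞ ⌊x⌋ₖ, so a
-- move of the game satisfies  step(⌊f⌋ₖ) = ⌊step f⌋ₖ₊₁.  For a non-capture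
-- state s with Tᵏ(s) = ∞ the algorithm computes Tᵏ⁺¹(s) = step(Tᵏ ∘ N(s)),
-- which therefore says ⌊T̄ s⌋ₖ₊₁ = ⌊step (T̄ ∘ N(s))⌋ₖ₊₁ whenever ⌊T̄ s⌋ₖ = ∞.
-- Since also ⌊T̄ s⌋₀ = ∞, these truncations already determine the value:
-- T̄ s = step (T̄ ∘ N(s)), which is the proposition for both players.

open import Defs
open import Data.Nat using (ℕ; zero; suc; _+_; _≤_; _≤?_; s≤s; s≤s⁻¹)
open import Data.Nat.Properties
  using (≤-refl; ≤-trans; ≤-total; n≤1+n; m≤m+n; m≤n+m; 1+n≰n;
         ⊓-comm; ⊔-comm; m≤n⇒m⊓n≡m; m≤n⇒m⊔n≡n)
open import Data.Bool using (true; false)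
open import Data.Product using (_×_; _,_; ∃-syntax)
open import Data.Sum using (inj₁; inj₂)
open import Data.List using ([]; _∷_)
open import Data.List.NonEmpty using (_∷_; foldr₁) renaming (map to map⁺)
open import Data.List.NonEmpty.Properties using (map-cong; map-∘)
open import Relation.Binary.PropositionalEquality
open import Relation.Nullary using (yes; no; ¬_)
open import Data.Empty using (⊥-elim)

trunc : ℕ → ℕ∞ → ℕ∞
trunc k ∞ = ∞
trunc k (fin m) with m ≤? k
... | yes _ = fin m
... | no _  = ∞

trunc-keeps : ∀ {k m} → m ≤ k → trunc k (fin m) ≡ fin m
trunc-keeps {k} {m} m≤k with m ≤? k
... | yes _  = refl
... | no m≰k = ⊥-elim (m≰k m≤k)

trunc-drops : ∀ {k m} → ¬ m ≤ k → trunc k (fin m) ≡ ∞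
trunc-drops {k} {m} m≰k with m ≤? k
... | yes m≤k = ⊥-elim (m≰k m≤k)
... | no _    = refl

trunc-fin : ∀ {k x n} → trunc k x ≡ fin n → x ≡ fin n
trunc-fin {k} {fin m} eq with m ≤? k
trunc-fin {k} {fin m} refl | yes _ = refl

trunc-trunc : ∀ {i j} x → i ≤ j → trunc i (trunc j x) ≡ trunc i x
trunc-trunc ∞ _ = refl
trunc-trunc {i} {j} (fin m) i≤j with m ≤? j
... | yes _  = refl
... | no m≰j = sym (trunc-drops (λ m≤i → m≰j (≤-trans m≤i i≤j)))

trunc-stable : ∀ {i j} x → i ≤ j → trunc i x ≡ x → trunc j x ≡ x
trunc-stable ∞ _ _ = refl
trunc-stable {i} (fin m) i≤j eq with m ≤? i
... | yes m≤i = trunc-keeps (≤-trans m≤i i≤j)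

trunc-suc∞ : ∀ k x → suc∞ (trunc k x) ≡ trunc (suc k) (suc∞ x)
trunc-suc∞ k ∞ = refl
trunc-suc∞ k (fin m) with m ≤? k
... | yes m≤k = sym (trunc-keeps (s≤s m≤k))
... | no m≰k  = sym (trunc-drops (λ sm≤sk → m≰k (s≤s⁻¹ sm≤sk)))

trunc-0-suc∞ : ∀ x → trunc 0 (suc∞ x) ≡ ∞
trunc-0-suc∞ ∞       = refl
trunc-0-suc∞ (fin m) = refl

⊓∞-comm : ∀ x y → x ⊓∞ y ≡ y ⊓∞ x
⊓∞-comm (fin m) (fin n) = cong fin (⊓-comm m n)
⊓∞-comm (fin m) ∞       = refl
⊓∞-comm ∞ (fin n)       = refl
⊓∞-comm ∞ ∞             = refl

⊔∞-comm : ∀ x y → x ⊔∞ y ≡ y ⊔∞ x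
⊔∞-comm (fin m) (fin n) = cong fin (⊔-comm m n)
⊔∞-comm (fin m) ∞       = refl
⊔∞-comm ∞ (fin n)       = refl
⊔∞-comm ∞ ∞             = refl

-- Truncation is monotone, hence commutes with min and max; first for
-- ordered finite arguments, then in general.
trunc-⊓-ordered : ∀ k {m n} → m ≤ n →
  trunc k (fin m) ≡ trunc k (fin m) ⊓∞ trunc k (fin n)
trunc-⊓-ordered k {m} {n} m≤n with m ≤? k | n ≤? k
... | yes _   | yes _   = cong fin (sym (m≤n⇒m⊓n≡m m≤n))
... | yes _   | no _    = refl
... | no m≰k  | yes n≤k = ⊥-elim (m≰k (≤-trans m≤n n≤k))
... | no _    | no _    = refl

trunc-⊔-ordered : ∀ k {m n} → m ≤ n →
  trunc k (fin n) ≡ trunc k (fin m) ⊔∞ trunc k (fin n)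
trunc-⊔-ordered k {m} {n} m≤n with m ≤? k | n ≤? k
... | yes _   | yes _   = cong fin (sym (m≤n⇒m⊔n≡n m≤n))
... | yes _   | no _    = refl
... | no m≰k  | yes n≤k = ⊥-elim (m≰k (≤-trans m≤n n≤k))
... | no _    | no _    = refl

trunc-⊓ : ∀ k x y → trunc k (x ⊓∞ y) ≡ trunc k x ⊓∞ trunc k y
trunc-⊓ k ∞ y = refl
trunc-⊓ k (fin m) ∞ = ⊓∞-comm ∞ (trunc k (fin m))
trunc-⊓ k (fin m) (fin n) with ≤-total m n
... | inj₁ m≤n rewrite m≤n⇒m⊓n≡m m≤n = trunc-⊓-ordered k m≤n
... | inj₂ n≤m rewrite ⊓-comm m n | m≤n⇒m⊓n≡m n≤m =
  trans (trunc-⊓-ordered k n≤m) (⊓∞-comm (trunc k (fin n)) (trunc k (fin m)))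

trunc-⊔ : ∀ k x y → trunc k (x ⊔∞ y) ≡ trunc k x ⊔∞ trunc k y
trunc-⊔ k ∞ y = refl
trunc-⊔ k (fin m) ∞ = ⊔∞-comm ∞ (trunc k (fin m))
trunc-⊔ k (fin m) (fin n) with ≤-total m n
... | inj₁ m≤n rewrite m≤n⇒m⊔n≡n m≤n = trunc-⊔-ordered k m≤n
... | inj₂ n≤m rewrite ⊔-comm m n | m≤n⇒m⊔n≡n n≤m =
  trans (trunc-⊔-ordered k n≤m) (⊔∞-comm (trunc k (fin n)) (trunc k (fin m)))

foldr₁-hom : ∀ {A : Set} (op : A → A → A) (h : A → A) →
  (∀ x y → h (op x y) ≡ op (h x) (h y)) →
  ∀ xs → foldr₁ op (map⁺ h xs) ≡ h (foldr₁ op xs)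
foldr₁-hom op h hom (x ∷ xs) = go x xs
  where
  go : ∀ x xs → foldr₁ op (map⁺ h (x ∷ xs)) ≡ h (foldr₁ op (x ∷ xs))
  go x []       = refl
  go x (y ∷ ys) = trans (cong (op (h x)) (go y ys)) (sym (hom x (foldr₁ op (y ∷ ys))))

trunc-determines : ∀ x y → trunc 0 x ≡ ∞ →
  (∀ k → trunc k x ≡ ∞ → trunc (suc k) x ≡ trunc (suc k) y) → x ≡ y
trunc-determines ∞ ∞ _ _ = refl
trunc-determines ∞ (fin m) _ agree
  with () ← trans (agree m refl) (trunc-keeps (n≤1+n m))
trunc-determines (fin (suc k)) y _ agree =
  sym (trunc-fin (sym (trans (sym (trunc-keeps ≤-refl)) (agree k (trunc-drops 1+n≰n)))))

module Labelling (G : GCR) where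
  open GCR G

  step-trunc : ∀ k p (g f : State → ℕ∞) → (∀ a → g a ≡ trunc k (f a)) →
    ∀ L → step p (map⁺ g L) ≡ trunc (suc k) (step p (map⁺ f L))
  step-trunc k p g f g≗ L = trans (cong (step p) moved) (by-player p)
    where
    moved : map⁺ g L ≡ map⁺ (trunc k) (map⁺ f L)
    moved = trans (map-cong g≗ L) (map-∘ L)
    by-player : ∀ p → step p (map⁺ (trunc k) (map⁺ f L)) ≡ trunc (suc k) (step p (map⁺ f L))
    by-player pursuer = trans (cong suc∞ (foldr₁-hom _⊓∞_ (trunc k) (trunc-⊓ k) (map⁺ f L)))
                              (trunc-suc∞ k (min⁺ (map⁺ f L)))
    by-player evader  = trans (cong suc∞ (foldr₁-hom _⊔∞_ (trunc k) (trunc-⊔ k) (map⁺ f L)))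
                              (trunc-suc∞ k (max⁺ (map⁺ f L)))

  T-unfolds : ∀ i s → T i s ≡ ∞ → T (suc i) s ≡ step (player s) (map⁺ (T i) (N s))
  T-unfolds i s eq with T i s
  T-unfolds i s refl | ∞ = refl

  T-0-noncapture : ∀ s → capture s ≡ false → T 0 s ≡ ∞
  T-0-noncapture s nc rewrite nc = refl

  T-bounded : ∀ i s → trunc i (T i s) ≡ T i s
  T-bounded zero s with capture s
  ... | true  = refl
  ... | false = refl
  T-bounded (suc i) s with T i s in eq
  ... | fin n = trunc-stable (fin n) (n≤1+n i) (subst (λ x → trunc i x ≡ x) eq (T-bounded i s))
  ... | ∞     = sym (step-trunc i (player s) (T i) (T i) (λ a → sym (T-bounded i a)) (N s))

  -- A label is never lost once assigned, so an infinite label was infinite before.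
  T-∞-earlier : ∀ i s → T (suc i) s ≡ ∞ → T i s ≡ ∞
  T-∞-earlier i s eq with T i s
  ... | ∞ = refl
  T-∞-earlier i s () | fin n

  trunc-0-step : ∀ p xs → trunc 0 (step p xs) ≡ ∞
  trunc-0-step pursuer xs = trunc-0-suc∞ (min⁺ xs)
  trunc-0-step evader  xs = trunc-0-suc∞ (max⁺ xs)

  T-truncates : ∀ i s → T i s ≡ trunc i (T (suc i) s)
  T-truncates i s with T i s in eq
  ... | fin n = sym (subst (λ x → trunc i x ≡ x) eq (T-bounded i s))
  T-truncates zero s    | ∞ = sym (trunc-0-step (player s) (map⁺ (T 0) (N s)))
  T-truncates (suc i) s | ∞ = begin
    ∞                                                     ≡⟨ sym eq ⟩
    T (suc i) s                                           ≡⟨ T-unfolds i s (T-∞-earlier i s eq) ⟩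
    step (player s) (map⁺ (T i) (N s))                    ≡⟨ step-trunc i (player s) (T i) (T (suc i)) (T-truncates i) (N s) ⟩
    trunc (suc i) (step (player s) (map⁺ (T (suc i)) (N s))) ∎
    where open ≡-Reasoning

  T-truncates-later : ∀ d i s → T i s ≡ trunc i (T (d + i) s)
  T-truncates-later zero    i s = sym (T-bounded i s)
  T-truncates-later (suc d) i s = begin
    T i s                                      ≡⟨ T-truncates-later d i s ⟩
    trunc i (T (d + i) s)                      ≡⟨ cong (trunc i) (T-truncates (d + i) s) ⟩
    trunc i (trunc (d + i) (T (suc d + i) s))  ≡⟨ trunc-trunc (T (suc d + i) s) (m≤n+m i d) ⟩
    trunc i (T (suc d + i) s)                  ∎
    where open ≡-Reasoning

  module Limit (T̄ : State → ℕ∞) (converges : ∀ s → ∃[ i ] (∀ j → i ≤ j → T j s ≡ T̄ s)) where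

    T-truncates-limit : ∀ k s → T k s ≡ trunc k (T̄ s)
    T-truncates-limit k s with converges s
    ... | i , stable = trans (T-truncates-later i k s) (cong (trunc k) (stable (i + k) (m≤m+n i k)))

    T̄-recursion : ∀ s → capture s ≡ false → T̄ s ≡ step (player s) (map⁺ T̄ (N s))
    T̄-recursion s nc = trunc-determines (T̄ s) (step (player s) (map⁺ T̄ (N s))) invisible-at-0 agree
      where
      invisible-at-0 : trunc 0 (T̄ s) ≡ ∞
      invisible-at-0 = trans (sym (T-truncates-limit 0 s)) (T-0-noncapture s nc)
      agree : ∀ k → trunc k (T̄ s) ≡ ∞ →
        trunc (suc k) (T̄ s) ≡ trunc (suc k) (step (player s) (map⁺ T̄ (N s)))
      agree k invisible = begin
        trunc (suc k) (T̄ s)                   ≡⟨ sym (T-truncates-limit (suc k) s) ⟩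
        T (suc k) s                            ≡⟨ T-unfolds k s (trans (T-truncates-limit k s) invisible) ⟩
        step (player s) (map⁺ (T k) (N s))     ≡⟨ step-trunc k (player s) (T k) T̄ (T-truncates-limit k) (N s) ⟩
        trunc (suc k) (step (player s) (map⁺ T̄ (N s))) ∎
        where open ≡-Reasoning

proposition3p4 : (G : GCR) → let open GCR G in
    (T̄ : State → ℕ∞) →
    (∀ s → ∃[ i ] (∀ j → i ≤ j → T j s ≡ T̄ s)) →
    (∀ s → player s ≡ pursuer → capture s ≡ false →
       T̄ s ≡ suc∞ (min⁺ (map⁺ T̄ (N s))))
    × (∀ s → player s ≡ evader → capture s ≡ false →
       T̄ s ≡ suc∞ (max⁺ (map⁺ T̄ (N s))))
proposition3p4 G T̄ converges = pursuer-moves , evader-moves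
  where
  open GCR G using (State; player; capture; N)
  open Labelling.Limit G T̄ converges using (T̄-recursion)
  pursuer-moves : ∀ s → player s ≡ pursuer → capture s ≡ false → T̄ s ≡ suc∞ (min⁺ (map⁺ T̄ (N s)))
  pursuer-moves (x , y , .pursuer) refl = T̄-recursion (x , y , pursuer)
  evader-moves : ∀ s → player s ≡ evader → capture s ≡ false → T̄ s ≡ suc∞ (max⁺ (map⁺ T̄ (N s)))
  evader-moves (x , y , .evader) refl = T̄-recursion (x , y , evader)
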